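{- Every integer $n$ can be written as $n=x^2-3y^2+z^2-3u^2$ with $x,y,z,u\in\mathbb{Z}$. -}

module Defs where

{-# OPTIONS --safe #-}
module Submission where

-- The form is the reduced norm of the quaternion algebra (3, -1)_ℚ, hence multiplicative; since it
-- represents -1, 2 and 3, it suffices to represent every prime p = 2h + 1 ≥ 5. By pigeonhole some
-- x, y ≤ h satisfy x² + 1 ≡ 3y² (mod p), which represents a multiple m p with 0 < |m| < p.
-- Lagrange's descent then lowers m: reduce the representing vector v modulo m to some w with
-- |norm w| < m² (in the two coordinates of positive weight one may choose between the two residues of
-- least absolute value, and consecutive choices move the norm by at most m²), and (v · conj w) / m
-- represents (norm w / m) p. The new multiplier is non-zero since the form is anisotropic (3 divides
-- every coordinate of a zero), and the reduction can only fail when every coordinate of v is an odd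
-- multiple of m / 2, which forces m² ∣ m p.

open import Defs
open import Data.Integer
  using (ℤ; +_; -[1+_]; NonZero; 0ℤ; 1ℤ; -_; _+_; _-_; _*_; _≤_; _<_; ∣_∣; +≤+; +<+)
open import Data.Integer.Properties
  using ( pos-+; pos-*; +-injective; abs-*; ∣i∣≡0⇒i≡0; ∣i+j∣≤∣i∣+∣j∣; ∣i-j∣≤∣i∣+∣j∣
        ; +-identityˡ; +-identityʳ; +-inverseˡ; *-identityˡ; *-zeroʳ; *-comm; -1*i≡-i; neg-distribʳ-*
        ; *-cancelˡ-≡; *-cancelʳ-≡; i-j≡0⇒i≡j; i≡j⇒i-j≡0; i*j≡0⇒i≡0∨j≡0
        ; i≤j⇒0≤j-i; 0≤i-j⇒j≤i; _<?_; ≮⇒≥; neg-cancel-<; drop‿+<+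
        ; +-mono-≤; +-monoˡ-≤; +-monoʳ-<; +-mono-≤-<; *-monoˡ-<-pos; *-cancelˡ-<-nonNeg
        ; module ≤-Reasoning )
open import Data.Integer.DivMod using (_%ℕ_; _/ℕ_; n%ℕd<d; a≡a%ℕn+[a/ℕn]*n)
open import Data.Integer.Divisibility.Signed
  using (_∣_; divides; quotient; ∣-refl; ∣⇒∣ᵤ; ∣ᵤ⇒∣; ∣m⇒∣-m; ∣m+n∣n⇒∣m; ∣n⇒∣m*n)
open import Data.Integer.Tactic.RingSolver using (solve-∀)
open import Data.Nat as ℕ using (ℕ; zero; suc)
import Data.Nat.Properties as ℕₚ
open import Data.Nat.DivMod using (m%n<n; m≡m%n+[m/n]*n)
open import Data.Nat.Divisibility as ℕᵈ using (n∣m⇒m%n≡0; ∣⇒≤) renaming (_∣_ to _∣ℕ_)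
open import Data.Nat.Divisibility.Core using (hasNonTrivialDivisor)
open import Data.Nat.Induction using (<-wellFounded; Acc; acc)
open import Data.Nat.ListAction using (product)
open import Data.Nat.Primality using (Prime; euclidsLemma; ¬prime[1]; prime⇒nonTrivial)
open import Data.Nat.Primality.Factorisation using (factorise; PrimeFactorisation)
open import Data.Nat.Tactic.RingSolver renaming (solve-∀ to ℕ-solve-∀)
open import Data.Fin as Fin using (Fin; toℕ; fromℕ<; splitAt; join)
import Data.Fin.Properties as Fₚ
open import Data.List using (_∷_)
open import Data.List.Relation.Unary.All using (All; []; _∷_)
import Data.List.Relation.Unary.All as All
open import Data.Empty using (⊥-elim)
open import Data.Product using (∃-syntax; ∃₂; _×_; _,_; proj₁; proj₂)
import Data.Product as Product
open import Data.Sum using (_⊎_; inj₁; inj₂; [_,_]′)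
import Data.Sum as Sum
open import Function using (_∘_)
open import Relation.Nullary using (¬_; yes; no)
open import Relation.Binary.PropositionalEquality
  using (_≡_; _≢_; refl; sym; trans; cong; cong₂; subst; module ≡-Reasoning)

-- The quaternion norm form

-- Elements x + y i + z j + u k with i² = 3, j² = -1 and k = i j, so that k² = 3.
record Quaternion : Set where
  constructor quat
  field re i j k : ℤ

norm : Quaternion → ℤ
norm (quat x y z u) = x * x - + 3 * (y * y) + z * z - + 3 * (u * u)

conj : Quaternion → Quaternion
conj (quat x y z u) = quat x (- y) (- z) (- u)

infixl 6 _⊕_
infixl 7 _·_ _⊛_

_·_ : Quaternion → Quaternion → Quaternion
quat x y z u · quat x′ y′ z′ u′ =
  quat (x * x′ + + 3 * (y * y′) - z * z′ + + 3 * (u * u′))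
       (x * y′ + y * x′ + z * u′ - u * z′)
       (x * z′ + z * x′ + + 3 * (y * u′) - + 3 * (u * y′))
       (x * u′ + u * x′ + y * z′ - z * y′)

_⊕_ : Quaternion → Quaternion → Quaternion
quat x y z u ⊕ quat x′ y′ z′ u′ = quat (x + x′) (y + y′) (z + z′) (u + u′)

_⊛_ : Quaternion → ℤ → Quaternion
quat x y z u ⊛ m = quat (x * m) (y * m) (z * m) (u * m)

real : ℤ → Quaternion
real r = quat r 0ℤ 0ℤ 0ℤ

𝟘 : Quaternion
𝟘 = real 0ℤ

polar : Quaternion → Quaternion → ℤ
polar (quat x y z u) (quat x′ y′ z′ u′) = x * x′ - + 3 * (y * y′) + z * z′ - + 3 * (u * u′)

quat-≡ : ∀ {x y z u x′ y′ z′ u′} → x ≡ x′ → y ≡ y′ → z ≡ z′ → u ≡ u′ → quat x y z u ≡ quat x′ y′ z′ u′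
quat-≡ refl refl refl refl = refl

𝟘-⊕ : ∀ q → 𝟘 ⊕ q ≡ q
𝟘-⊕ (quat x y z u) = quat-≡ (+-identityˡ x) (+-identityˡ y) (+-identityˡ z) (+-identityˡ u)

norm-· : ∀ p q → norm (p · q) ≡ norm p * norm q
norm-· (quat x y z u) (quat x′ y′ z′ u′) = identity x y z u x′ y′ z′ u′
  where
  identity : ∀ x y z u x′ y′ z′ u′ →
    let a = x * x′ + + 3 * (y * y′) - z * z′ + + 3 * (u * u′)
        b = x * y′ + y * x′ + z * u′ - u * z′
        c = x * z′ + z * x′ + + 3 * (y * u′) - + 3 * (u * y′)
        d = x * u′ + u * x′ + y * z′ - z * y′
    in a * a - + 3 * (b * b) + c * c - + 3 * (d * d)
       ≡ (x * x - + 3 * (y * y) + z * z - + 3 * (u * u)) * (x′ * x′ - + 3 * (y′ * y′) + z′ * z′ - + 3 * (u′ * u′))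
  identity = solve-∀

norm-conj : ∀ q → norm (conj q) ≡ norm q
norm-conj (quat x y z u) = identity x y z u
  where
  identity : ∀ x y z u →
    x * x - + 3 * (- y * - y) + - z * - z - + 3 * (- u * - u) ≡ x * x - + 3 * (y * y) + z * z - + 3 * (u * u)
  identity = solve-∀

norm-⊛ : ∀ q m → norm (q ⊛ m) ≡ norm q * (m * m)
norm-⊛ (quat x y z u) m = identity x y z u m
  where
  identity : ∀ x y z u m →
    x * m * (x * m) - + 3 * (y * m * (y * m)) + z * m * (z * m) - + 3 * (u * m * (u * m))
    ≡ (x * x - + 3 * (y * y) + z * z - + 3 * (u * u)) * (m * m)
  identity = solve-∀

norm-⊕⊛ : ∀ w t m → norm (w ⊕ t ⊛ m) ≡ norm w + m * (+ 2 * polar w t + m * norm t)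
norm-⊕⊛ (quat x y z u) (quat x′ y′ z′ u′) m = identity x y z u x′ y′ z′ u′ m
  where
  identity : ∀ x y z u x′ y′ z′ u′ m →
    (x + x′ * m) * (x + x′ * m) - + 3 * ((y + y′ * m) * (y + y′ * m))
      + (z + z′ * m) * (z + z′ * m) - + 3 * ((u + u′ * m) * (u + u′ * m))
    ≡ (x * x - + 3 * (y * y) + z * z - + 3 * (u * u))
      + m * (+ 2 * (x * x′ - + 3 * (y * y′) + z * z′ - + 3 * (u * u′))
             + m * (x′ * x′ - + 3 * (y′ * y′) + z′ * z′ - + 3 * (u′ * u′)))
  identity = solve-∀

norm-as-difference : ∀ x y z u → norm (quat x y z u) ≡ (x * x + z * z) - + 3 * (y * y + u * u)
norm-as-difference x y z u = identity x y z u
  where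
  identity : ∀ x y z u → x * x - + 3 * (y * y) + z * z - + 3 * (u * u) ≡ (x * x + z * z) - + 3 * (y * y + u * u)
  identity = solve-∀

·-conj-⊕⊛ : ∀ w t m → (w ⊕ t ⊛ m) · conj w ≡ real (norm w) ⊕ (t · conj w) ⊛ m
·-conj-⊕⊛ (quat x y z u) (quat x′ y′ z′ u′) m =
  quat-≡ (re x y z u x′ y′ z′ u′ m) (i x y z u x′ y′ z′ u′ m) (j x y z u x′ y′ z′ u′ m) (k x y z u x′ y′ z′ u′ m)
  where
  re : ∀ x y z u x′ y′ z′ u′ m →
    (x + x′ * m) * x + + 3 * ((y + y′ * m) * - y) - (z + z′ * m) * - z + + 3 * ((u + u′ * m) * - u)
    ≡ (x * x - + 3 * (y * y) + z * z - + 3 * (u * u)) + (x′ * x + + 3 * (y′ * - y) - z′ * - z + + 3 * (u′ * - u)) * m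
  re = solve-∀
  i : ∀ x y z u x′ y′ z′ u′ m →
    (x + x′ * m) * - y + (y + y′ * m) * x + (z + z′ * m) * - u - (u + u′ * m) * - z
    ≡ 0ℤ + (x′ * - y + y′ * x + z′ * - u - u′ * - z) * m
  i = solve-∀
  j : ∀ x y z u x′ y′ z′ u′ m →
    (x + x′ * m) * - z + (z + z′ * m) * x + + 3 * ((y + y′ * m) * - u) - + 3 * ((u + u′ * m) * - y)
    ≡ 0ℤ + (x′ * - z + z′ * x + + 3 * (y′ * - u) - + 3 * (u′ * - y)) * m
  j = solve-∀
  k : ∀ x y z u x′ y′ z′ u′ m →
    (x + x′ * m) * - u + (u + u′ * m) * x + (y + y′ * m) * - z - (z + z′ * m) * - y
    ≡ 0ℤ + (x′ * - u + u′ * x + y′ * - z - z′ * - y) * m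
  k = solve-∀

⊛-distrib-real-⊕ : ∀ r q m → (real r ⊕ q) ⊛ m ≡ real (m * r) ⊕ q ⊛ m
⊛-distrib-real-⊕ r (quat a b c d) m = quat-≡ (identity r a m) (zero-left b m) (zero-left c m) (zero-left d m)
  where
  identity : ∀ r a m → (r + a) * m ≡ m * r + a * m
  identity = solve-∀
  zero-left : ∀ b m → (0ℤ + b) * m ≡ 0ℤ + b * m
  zero-left b m = trans (cong (_* m) (+-identityˡ b)) (sym (+-identityˡ (b * m)))

-- For v = w ⊕ t ⊛ m and norm w = m r, the quaternion real r ⊕ t · conj w is (v · conj w) / m.
norm-descended : ∀ w t m r → norm w ≡ m * r → norm (real r ⊕ t · conj w) * (m * m) ≡ norm (w ⊕ t ⊛ m) * norm w
norm-descended w t m r Nw≡mr = begin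
  norm (real r ⊕ t · conj w) * (m * m)    ≡⟨ norm-⊛ (real r ⊕ t · conj w) m ⟨
  norm ((real r ⊕ t · conj w) ⊛ m)        ≡⟨ cong norm (⊛-distrib-real-⊕ r (t · conj w) m) ⟩
  norm (real (m * r) ⊕ (t · conj w) ⊛ m)  ≡⟨ cong (λ n → norm (real n ⊕ (t · conj w) ⊛ m)) Nw≡mr ⟨
  norm (real (norm w) ⊕ (t · conj w) ⊛ m) ≡⟨ cong norm (·-conj-⊕⊛ w t m) ⟨
  norm ((w ⊕ t ⊛ m) · conj w)             ≡⟨ norm-· (w ⊕ t ⊛ m) (conj w) ⟩
  norm (w ⊕ t ⊛ m) * norm (conj w)        ≡⟨ cong (norm (w ⊕ t ⊛ m) *_) (norm-conj w) ⟩
  norm (w ⊕ t ⊛ m) * norm w               ∎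
  where open ≡-Reasoning

Represented : ℤ → Set
Represented n = ∃[ q ] norm q ≡ n

represented-* : ∀ {m n} → Represented m → Represented n → Represented (m * n)
represented-* (p , refl) (q , refl) = p · q , norm-· p q

represented-neg : ∀ {n} → Represented n → Represented (- n)
represented-neg {n} r = subst Represented (-1*i≡-i n) (represented-* (quat 1ℤ 1ℤ 1ℤ 0ℤ , refl) r)

represented-product : ∀ {ps} → All (Represented ∘ +_) ps → Represented (+ product ps)
represented-product []                   = real 1ℤ , refl
represented-product {p ∷ ps} (rp ∷ rps) =
  subst Represented (sym (pos-* p (product ps))) (represented-* rp (represented-product rps))

represented-abs : ∀ p r → Represented (+ p * r) → Represented (+ ∣ r ∣ * + p)
represented-abs p (+ n)    rep = subst Represented (*-comm (+ p) (+ n)) rep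
represented-abs p -[1+ n ] rep = subst Represented (identity (+ p) (+ suc n)) (represented-neg rep)
  where
  identity : ∀ a b → - (a * - b) ≡ b * a
  identity = solve-∀

-- Anisotropy

k*n≡0⇒n≡0 : ∀ k {n} .{{_ : NonZero k}} → k * n ≡ 0ℤ → n ≡ 0ℤ
k*n≡0⇒n≡0 k {n} kn≡0 = *-cancelˡ-≡ k n 0ℤ (trans kn≡0 (sym (*-zeroʳ k)))

%ℕ≡0⇒∣ : ∀ n x .{{_ : ℕ.NonZero n}} → x %ℕ n ≡ 0 → + n ∣ x
%ℕ≡0⇒∣ n x r≡0 = divides (x /ℕ n) (begin
  x                         ≡⟨ a≡a%ℕn+[a/ℕn]*n x n ⟩
  + (x %ℕ n) + x /ℕ n * + n ≡⟨ cong (λ r → + r + x /ℕ n * + n) r≡0 ⟩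
  0ℤ + x /ℕ n * + n         ≡⟨ +-identityˡ _ ⟩
  x /ℕ n * + n              ∎)
  where open ≡-Reasoning

squares-mod-3 : ∀ r s → r ℕ.< 3 → s ℕ.< 3 → (r ℕ.* r ℕ.+ s ℕ.* s) ℕ.% 3 ≡ 0 → r ≡ 0 × s ≡ 0
squares-mod-3 0 0 _ _ _ = refl , refl
squares-mod-3 0 1 _ _ ()
squares-mod-3 0 2 _ _ ()
squares-mod-3 1 0 _ _ ()
squares-mod-3 1 1 _ _ ()
squares-mod-3 1 2 _ _ ()
squares-mod-3 2 0 _ _ ()
squares-mod-3 2 1 _ _ ()
squares-mod-3 2 2 _ _ ()
squares-mod-3 (suc (suc (suc _))) _ (ℕ.s≤s (ℕ.s≤s (ℕ.s≤s ()))) _ _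
squares-mod-3 _ (suc (suc (suc _))) _ (ℕ.s≤s (ℕ.s≤s (ℕ.s≤s ()))) _

3∣sum-of-squares : ∀ x y → + 3 ∣ x * x + y * y → (+ 3 ∣ x) × (+ 3 ∣ y)
3∣sum-of-squares x y 3∣x²+y² = Product.map (%ℕ≡0⇒∣ 3 x) (%ℕ≡0⇒∣ 3 y)
  (squares-mod-3 r s (n%ℕd<d x 3) (n%ℕd<d y 3) (n∣m⇒m%n≡0 _ 3 (∣⇒∣ᵤ 3∣r²+s²)))
  where
  open ≡-Reasoning
  r = x %ℕ 3
  s = y %ℕ 3
  k = x /ℕ 3 * (+ 2 * + r + + 3 * (x /ℕ 3)) + y /ℕ 3 * (+ 2 * + s + + 3 * (y /ℕ 3))
  expand : ∀ R S a b → (R + a * + 3) * (R + a * + 3) + (S + b * + 3) * (S + b * + 3)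
                       ≡ (R * R + S * S) + (a * (+ 2 * R + + 3 * a) + b * (+ 2 * S + + 3 * b)) * + 3
  expand = solve-∀
  x²+y²≡r²+s²+3k : x * x + y * y ≡ + (r ℕ.* r ℕ.+ s ℕ.* s) + k * + 3
  x²+y²≡r²+s²+3k = begin
    x * x + y * y
      ≡⟨ cong₂ (λ x y → x * x + y * y) (a≡a%ℕn+[a/ℕn]*n x 3) (a≡a%ℕn+[a/ℕn]*n y 3) ⟩
    (+ r + x /ℕ 3 * + 3) * (+ r + x /ℕ 3 * + 3) + (+ s + y /ℕ 3 * + 3) * (+ s + y /ℕ 3 * + 3)
      ≡⟨ expand (+ r) (+ s) (x /ℕ 3) (y /ℕ 3) ⟩
    (+ r * + r + + s * + s) + k * + 3
      ≡⟨ cong (_+ k * + 3) (sym (trans (pos-+ (r ℕ.* r) (s ℕ.* s)) (cong₂ _+_ (pos-* r r) (pos-* s s)))) ⟩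
    + (r ℕ.* r ℕ.+ s ℕ.* s) + k * + 3
      ∎
  3∣r²+s² : + 3 ∣ + (r ℕ.* r ℕ.+ s ℕ.* s)
  3∣r²+s² = ∣m+n∣n⇒∣m (subst (+ 3 ∣_) x²+y²≡r²+s²+3k 3∣x²+y²) (∣n⇒∣m*n k ∣-refl)

norm≡0⇒3∣x,z : ∀ x y z u → norm (quat x y z u) ≡ 0ℤ → (+ 3 ∣ x) × (+ 3 ∣ z)
norm≡0⇒3∣x,z x y z u N≡0 = 3∣sum-of-squares x z (divides (y * y + u * u) (begin
  x * x + z * z                               ≡⟨ rearrange x y z u ⟩
  norm (quat x y z u) + (y * y + u * u) * + 3 ≡⟨ cong (_+ _) N≡0 ⟩
  0ℤ + (y * y + u * u) * + 3                  ≡⟨ +-identityˡ _ ⟩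
  (y * y + u * u) * + 3                       ∎))
  where
  open ≡-Reasoning
  rearrange : ∀ x y z u → x * x + z * z ≡ (x * x - + 3 * (y * y) + z * z - + 3 * (u * u)) + (y * y + u * u) * + 3
  rearrange = solve-∀

norm-triple-x,z : ∀ a y b u → norm (quat (a * + 3) y (b * + 3) u) ≡ - + 3 * norm (quat y a u b)
norm-triple-x,z a y b u = identity a y b u
  where
  identity : ∀ a y b u →
    a * + 3 * (a * + 3) - + 3 * (y * y) + b * + 3 * (b * + 3) - + 3 * (u * u)
    ≡ - + 3 * (y * y - + 3 * (a * a) + u * u - + 3 * (b * b))
  identity = solve-∀

norm≡0⇒third : ∀ q → norm q ≡ 0ℤ → ∃[ q′ ] q ≡ q′ ⊛ + 3 × norm q′ ≡ 0ℤ
norm≡0⇒third (quat x y z u) N≡0 = quat a c b d , q≡q′⊛3 , N′≡0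
  where
  open ≡-Reasoning
  3∣x,z = norm≡0⇒3∣x,z x y z u N≡0
  a = quotient (proj₁ 3∣x,z)
  b = quotient (proj₂ 3∣x,z)
  x≡a3 = _∣_.equality (proj₁ 3∣x,z)
  z≡b3 = _∣_.equality (proj₂ 3∣x,z)
  3∣y,u = norm≡0⇒3∣x,z y a u b (k*n≡0⇒n≡0 (- + 3) (begin
    - + 3 * norm (quat y a u b)         ≡⟨ norm-triple-x,z a y b u ⟨
    norm (quat (a * + 3) y (b * + 3) u) ≡⟨ cong₂ (λ x z → norm (quat x y z u)) x≡a3 z≡b3 ⟨
    norm (quat x y z u)                 ≡⟨ N≡0 ⟩
    0ℤ                                  ∎))
  c = quotient (proj₁ 3∣y,u)
  d = quotient (proj₂ 3∣y,u)
  q≡q′⊛3 : quat x y z u ≡ quat a c b d ⊛ + 3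
  q≡q′⊛3 = quat-≡ x≡a3 (_∣_.equality (proj₁ 3∣y,u)) z≡b3 (_∣_.equality (proj₂ 3∣y,u))
  N′≡0 : norm (quat a c b d) ≡ 0ℤ
  N′≡0 = k*n≡0⇒n≡0 (+ 9) (begin
    + 9 * norm (quat a c b d) ≡⟨ *-comm (+ 9) _ ⟩
    norm (quat a c b d) * + 9 ≡⟨ norm-⊛ (quat a c b d) (+ 3) ⟨
    norm (quat a c b d ⊛ + 3) ≡⟨ cong norm q≡q′⊛3 ⟨
    norm (quat x y z u)       ≡⟨ N≡0 ⟩
    0ℤ                        ∎)

size : Quaternion → ℕ
size (quat x y z u) = ∣ x ∣ ℕ.+ ∣ y ∣ ℕ.+ ∣ z ∣ ℕ.+ ∣ u ∣

size-⊛3 : ∀ q → size (q ⊛ + 3) ≡ size q ℕ.* 3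
size-⊛3 (quat x y z u)
  rewrite abs-* x (+ 3) | abs-* y (+ 3) | abs-* z (+ 3) | abs-* u (+ 3) = identity (∣ x ∣) (∣ y ∣) (∣ z ∣) (∣ u ∣)
  where
  identity : ∀ a b c d → a ℕ.* 3 ℕ.+ b ℕ.* 3 ℕ.+ c ℕ.* 3 ℕ.+ d ℕ.* 3 ≡ (a ℕ.+ b ℕ.+ c ℕ.+ d) ℕ.* 3
  identity = ℕ-solve-∀

size≡0⇒𝟘 : ∀ q → size q ≡ 0 → q ≡ 𝟘
size≡0⇒𝟘 (quat x y z u) size≡0 = quat-≡ (∣i∣≡0⇒i≡0 ∣x∣≡0) (∣i∣≡0⇒i≡0 ∣y∣≡0) (∣i∣≡0⇒i≡0 ∣z∣≡0) (∣i∣≡0⇒i≡0 ∣u∣≡0)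
  where
  ∣x∣+∣y∣+∣z∣≡0 = ℕₚ.m+n≡0⇒m≡0 (∣ x ∣ ℕ.+ ∣ y ∣ ℕ.+ ∣ z ∣) size≡0
  ∣x∣+∣y∣≡0 = ℕₚ.m+n≡0⇒m≡0 (∣ x ∣ ℕ.+ ∣ y ∣) ∣x∣+∣y∣+∣z∣≡0
  ∣x∣≡0 = ℕₚ.m+n≡0⇒m≡0 ∣ x ∣ ∣x∣+∣y∣≡0
  ∣y∣≡0 = ℕₚ.m+n≡0⇒n≡0 ∣ x ∣ ∣x∣+∣y∣≡0
  ∣z∣≡0 = ℕₚ.m+n≡0⇒n≡0 (∣ x ∣ ℕ.+ ∣ y ∣) ∣x∣+∣y∣+∣z∣≡0
  ∣u∣≡0 = ℕₚ.m+n≡0⇒n≡0 (∣ x ∣ ℕ.+ ∣ y ∣ ℕ.+ ∣ z ∣) size≡0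

anisotropic : ∀ q → norm q ≡ 0ℤ → q ≡ 𝟘
anisotropic q = go q (<-wellFounded (size q))
  where
  go : ∀ q → Acc ℕ._<_ (size q) → norm q ≡ 0ℤ → q ≡ 𝟘
  go q (acc smaller) N≡0 = descend (norm≡0⇒third q N≡0)
    where
    descend : ∃[ q′ ] q ≡ q′ ⊛ + 3 × norm q′ ≡ 0ℤ → q ≡ 𝟘
    descend (q′ , q≡q′⊛3 , N′≡0) = trans q≡q′⊛3 (cong (_⊛ + 3) (q′≡𝟘 (size q′) refl))
      where
      q′≡𝟘 : ∀ n → size q′ ≡ n → q′ ≡ 𝟘
      q′≡𝟘 zero    size≡0 = size≡0⇒𝟘 q′ size≡0
      q′≡𝟘 (suc n) size≡n = go q′ (smaller size-shrinks) N′≡0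
        where
        size-shrinks : size q′ ℕ.< size q
        size-shrinks = subst (size q′ ℕ.<_) (trans (sym (size-⊛3 q′)) (cong size (sym q≡q′⊛3)))
                         (subst (λ s → s ℕ.< s ℕ.* 3) (sym size≡n) (ℕₚ.m<m*n (suc n) 3 (ℕ.s≤s (ℕ.s≤s ℕ.z≤n))))

-- Reduction modulo m

0≤+ : ∀ n → 0ℤ ≤ + n
0≤+ n = +≤+ ℕ.z≤n

0≤* : ∀ {a b} → 0ℤ ≤ a → 0ℤ ≤ b → 0ℤ ≤ a * b
0≤* {+ m} {+ n} _ _ = subst (0ℤ ≤_) (pos-* m n) (0≤+ (m ℕ.* n))

0≤square : ∀ x → 0ℤ ≤ x * x
0≤square (+ n)    = 0≤* (0≤+ n) (0≤+ n)
0≤square -[1+ n ] = +≤+ ℕ.z≤n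

0<square : ∀ m .{{_ : ℕ.NonZero m}} → 0ℤ < + m * + m
0<square (suc n) = +<+ (ℕ.s≤s ℕ.z≤n)

≤-by-difference : ∀ {x y} d → 0ℤ ≤ d → y - x ≡ d → x ≤ y
≤-by-difference d 0≤d y-x≡d = 0≤i-j⇒j≤i (subst (0ℤ ≤_) (sym y-x≡d) 0≤d)

<-by-difference : ∀ {x y} d → 0ℤ < d → y - x ≡ d → x < y
<-by-difference {x} {y} d 0<d y-x≡d = begin-strict
  x           ≡⟨ +-identityʳ x ⟨
  x + 0ℤ      <⟨ +-monoʳ-< x 0<d ⟩
  x + d       ≡⟨ cong (_+_ x) y-x≡d ⟨
  x + (y - x) ≡⟨ identity x y ⟩
  y           ∎
  where
  open ≤-Reasoning
  identity : ∀ x y → x + (y - x) ≡ y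
  identity = solve-∀

nonneg-sum≡0 : ∀ {a b} → 0ℤ ≤ a → 0ℤ ≤ b → a + b ≡ 0ℤ → a ≡ 0ℤ × b ≡ 0ℤ
nonneg-sum≡0 {+ zero}  {+ zero}  _ _ _ = refl , refl
nonneg-sum≡0 {+ zero}  {+ suc _} _ _ ()
nonneg-sum≡0 {+ suc _} {+ _}     _ _ ()

complementary-squares : ∀ m s → 0ℤ ≤ s → + 2 * s ≤ m →
  (+ 4 * (s * s) ≤ m * m) × (m * m ≤ + 4 * ((m - s) * (m - s))) × ((m - s) * (m - s) ≤ s * s + m * m)
complementary-squares m s 0≤s 2s≤m =
  ≤-by-difference (d * (d + + 4 * s)) (0≤* 0≤d (+-mono-≤ 0≤d 0≤4s)) (identity₁ m s) ,
  ≤-by-difference (d * (+ 3 * d + + 4 * s)) (0≤* 0≤d (+-mono-≤ (0≤* (0≤+ 3) 0≤d) 0≤4s)) (identity₂ m s) ,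
  ≤-by-difference (s * (+ 2 * d + + 4 * s)) (0≤* 0≤s (+-mono-≤ (0≤* (0≤+ 2) 0≤d) 0≤4s)) (identity₃ m s)
  where
  d = m - + 2 * s
  0≤d = i≤j⇒0≤j-i 2s≤m
  0≤4s = 0≤* (0≤+ 4) 0≤s
  identity₁ : ∀ m s → m * m - + 4 * (s * s) ≡ (m - + 2 * s) * ((m - + 2 * s) + + 4 * s)
  identity₁ = solve-∀
  identity₂ : ∀ m s → + 4 * ((m - s) * (m - s)) - m * m ≡ (m - + 2 * s) * (+ 3 * (m - + 2 * s) + + 4 * s)
  identity₂ = solve-∀
  identity₃ : ∀ m s → s * s + m * m - (m - s) * (m - s) ≡ s * (+ 2 * (m - + 2 * s) + + 4 * s)
  identity₃ = solve-∀

-- near and far are the two representatives of c in (-m, m) nearest to 0, of absolute values s ≤ m / 2 and m - s.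
record BalancedResidues (m : ℕ) (c : ℤ) : Set where
  field
    near far nearQuot farQuot : ℤ
    c≡near     : c ≡ near + nearQuot * + m
    c≡far      : c ≡ far + farQuot * + m
    near-small : + 4 * (near * near) ≤ + m * + m
    far-large  : + m * + m ≤ + 4 * (far * far)
    far-close  : far * far ≤ near * near + + m * + m

balanced-residues : ∀ m .{{_ : ℕ.NonZero m}} c → BalancedResidues m c
balanced-residues m c = from-residue (c %ℕ m) (c /ℕ m) (n%ℕd<d c m) (a≡a%ℕn+[a/ℕn]*n c m)
  where
  M = + m
  next-quotient : ∀ r q m → r + q * m ≡ r - m + (q + 1ℤ) * m
  next-quotient = solve-∀
  swap-square : ∀ a b → (a - b) * (a - b) ≡ (b - a) * (b - a)
  swap-square = solve-∀
  double-complement : ∀ m r → m - + 2 * (m - r) ≡ + 2 * r - m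
  double-complement = solve-∀
  double-negation : ∀ m r → r * r ≡ (m - (m - r)) * (m - (m - r))
  double-negation = solve-∀
  bounds : ∀ s w w′ → 0ℤ ≤ s → + 2 * s ≤ M → w * w ≡ s * s → w′ * w′ ≡ (M - s) * (M - s) →
    (+ 4 * (w * w) ≤ M * M) × (M * M ≤ + 4 * (w′ * w′)) × (w′ * w′ ≤ w * w + M * M)
  bounds s w w′ 0≤s 2s≤M w²≡s² w′²≡[M-s]² rewrite w²≡s² | w′²≡[M-s]² = complementary-squares M s 0≤s 2s≤M
  from-residue : ∀ r q → r ℕ.< m → c ≡ + r + q * M → BalancedResidues m c
  from-residue r q r<m c≡r+qM with 2 ℕ.* r ℕₚ.≤? m
  ... | yes 2r≤m = record
    { near = R ; nearQuot = q ; c≡near = c≡r+qM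
    ; far = R - M ; farQuot = q + 1ℤ ; c≡far = trans c≡r+qM (next-quotient R q M)
    ; near-small = proj₁ b ; far-large = proj₁ (proj₂ b) ; far-close = proj₂ (proj₂ b) }
    where
    R = + r
    b = bounds R R (R - M) (0≤+ r) (subst (_≤ M) (pos-* 2 r) (+≤+ 2r≤m)) refl (swap-square R M)
  ... | no 2r≰m = record
    { near = R - M ; nearQuot = q + 1ℤ ; c≡near = trans c≡r+qM (next-quotient R q M)
    ; far = R ; farQuot = q ; c≡far = c≡r+qM
    ; near-small = proj₁ b ; far-large = proj₁ (proj₂ b) ; far-close = proj₂ (proj₂ b) }
    where
    R = + r
    M≤2R : M ≤ + 2 * R
    M≤2R = subst (M ≤_) (pos-* 2 r) (+≤+ (ℕₚ.<⇒≤ (ℕₚ.≰⇒> 2r≰m)))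
    b = bounds (M - R) (R - M) R (i≤j⇒0≤j-i (+≤+ (ℕₚ.<⇒≤ r<m)))
               (≤-by-difference (+ 2 * R - M) (i≤j⇒0≤j-i M≤2R) (double-complement M R))
               (swap-square R M) (double-negation M R)

Within : ℤ → ℤ → Set
Within K d = - K < d × d < K

enter-window : ∀ {K d} → d < K → Within K d ⊎ d ≤ - K
enter-window {K} {d} d<K with - K <? d
... | yes -K<d = inj₁ (-K<d , d<K)
... | no  -K≮d = inj₂ (≮⇒≥ -K≮d)

climb : ∀ {K d d′} → 0ℤ < K → d ≤ - K → d′ ≤ d + K → d′ < K
climb {K} {d} {d′} 0<K d≤-K d′≤d+K = begin-strict
  d′      ≤⟨ d′≤d+K ⟩
  d + K   ≤⟨ +-monoˡ-≤ K d≤-K ⟩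
  - K + K ≡⟨ +-inverseˡ K ⟩
  0ℤ      <⟨ 0<K ⟩
  K       ∎
  where open ≤-Reasoning

-- Moving up in steps of at most K, one cannot jump over the open window (-K, K) of width 2K.
window-search : ∀ {K d₁ d₂ d₃} → 0ℤ < K → d₁ < K → d₂ ≤ d₁ + K → d₃ ≤ d₂ + K →
  Within K d₁ ⊎ Within K d₂ ⊎ Within K d₃ ⊎ d₃ ≤ - K
window-search 0<K d₁<K d₂≤ d₃≤ with enter-window d₁<K
... | inj₁ in₁ = inj₁ in₁
... | inj₂ d₁≤-K with enter-window (climb 0<K d₁≤-K d₂≤)
...   | inj₁ in₂ = inj₂ (inj₁ in₂)
...   | inj₂ d₂≤-K with enter-window (climb 0<K d₂≤-K d₃≤)
...     | inj₁ in₃   = inj₂ (inj₂ (inj₁ in₃))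
...     | inj₂ d₃≤-K = inj₂ (inj₂ (inj₂ d₃≤-K))

below-window⇒tight : ∀ {K a b c d} → K ≤ + 4 * a → K ≤ + 4 * b → + 4 * c ≤ K → + 4 * d ≤ K →
  (a + b) - + 3 * (c + d) ≤ - K → + 4 * a ≡ K × + 4 * b ≡ K × + 4 * c ≡ K × + 4 * d ≡ K
below-window⇒tight {K} {a} {b} {c} {d} K≤4a K≤4b 4c≤K 4d≤K gap≤-K =
  i-j≡0⇒i≡j _ _ (proj₁ split₁) ,
  i-j≡0⇒i≡j _ _ (proj₁ split₂) ,
  sym (i-j≡0⇒i≡j _ _ (k*n≡0⇒n≡0 (+ 3) (proj₁ split₃))) ,
  sym (i-j≡0⇒i≡j _ _ (k*n≡0⇒n≡0 (+ 3) (proj₁ split₄)))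
  where
  -- a positive combination of the five (nonnegative) slacks vanishes
  slacks : ∀ K a b c d →
    (+ 4 * a - K) + ((+ 4 * b - K) + (+ 3 * (K - + 4 * c) + (+ 3 * (K - + 4 * d) + + 4 * (- K - ((a + b) - + 3 * (c + d))))))
    ≡ 0ℤ
  slacks = solve-∀
  0≤e₃ = 0≤* (0≤+ 3) (i≤j⇒0≤j-i 4c≤K)
  0≤e₄ = 0≤* (0≤+ 3) (i≤j⇒0≤j-i 4d≤K)
  0≤e₅ = 0≤* (0≤+ 4) (i≤j⇒0≤j-i gap≤-K)
  split₁ = nonneg-sum≡0 (i≤j⇒0≤j-i K≤4a) (+-mono-≤ (i≤j⇒0≤j-i K≤4b) (+-mono-≤ 0≤e₃ (+-mono-≤ 0≤e₄ 0≤e₅)))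
             (slacks K a b c d)
  split₂ = nonneg-sum≡0 (i≤j⇒0≤j-i K≤4b) (+-mono-≤ 0≤e₃ (+-mono-≤ 0≤e₄ 0≤e₅)) (proj₂ split₁)
  split₃ = nonneg-sum≡0 0≤e₃ (+-mono-≤ 0≤e₄ 0≤e₅) (proj₂ split₂)
  split₄ = nonneg-sum≡0 0≤e₄ 0≤e₅ (proj₂ split₃)

square-root-up-to-sign : ∀ x y → x * x ≡ y * y → x ≡ y ⊎ x ≡ - y
square-root-up-to-sign x y x²≡y² =
  Sum.map (i-j≡0⇒i≡j x y) (i-j≡0⇒i≡j x (- y)) (i*j≡0⇒i≡0∨j≡0 (x - y) (trans (factor x y) (i≡j⇒i-j≡0 x²≡y²)))
  where
  factor : ∀ x y → (x - y) * (x - - y) ≡ x * x - y * y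
  factor = solve-∀

record HalfOddMultiple (m x : ℤ) : Set where
  constructor half-odd
  field
    index : ℤ
    twice : x * + 2 ≡ m * (1ℤ + + 2 * index)

half-odd-multiple : ∀ {m c} w t → + 4 * (w * w) ≡ m * m → c ≡ w + t * m → HalfOddMultiple m c
half-odd-multiple {m} w t 4w²≡m² refl = from-sign (square-root-up-to-sign (+ 2 * w) m (trans (identity w) 4w²≡m²))
  where
  open ≡-Reasoning
  identity : ∀ w → + 2 * w * (+ 2 * w) ≡ + 4 * (w * w)
  identity = solve-∀
  expand : ∀ w t m → (w + t * m) * + 2 ≡ + 2 * w + m * (+ 2 * t)
  expand = solve-∀
  from-sign : + 2 * w ≡ m ⊎ + 2 * w ≡ - m → HalfOddMultiple m (w + t * m)
  from-sign (inj₁ 2w≡m) = half-odd t (begin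
    (w + t * m) * + 2       ≡⟨ expand w t m ⟩
    + 2 * w + m * (+ 2 * t) ≡⟨ cong (_+ m * (+ 2 * t)) 2w≡m ⟩
    m + m * (+ 2 * t)       ≡⟨ factor m t ⟩
    m * (1ℤ + + 2 * t)      ∎)
    where
    factor : ∀ m t → m + m * (+ 2 * t) ≡ m * (1ℤ + + 2 * t)
    factor = solve-∀
  from-sign (inj₂ 2w≡-m) = half-odd (t - 1ℤ) (begin
    (w + t * m) * + 2         ≡⟨ expand w t m ⟩
    + 2 * w + m * (+ 2 * t)   ≡⟨ cong (_+ m * (+ 2 * t)) 2w≡-m ⟩
    - m + m * (+ 2 * t)       ≡⟨ factor m t ⟩
    m * (1ℤ + + 2 * (t - 1ℤ)) ∎)
    where
    factor : ∀ m t → - m + m * (+ 2 * t) ≡ m * (1ℤ + + 2 * (t - 1ℤ))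
    factor = solve-∀

-- Odd squares are 1 modulo 4, and 1 - 3 + 1 - 3 ≡ 0 (mod 4).
norm-of-half-odd-multiples : ∀ {m x y z u} →
  HalfOddMultiple m x → HalfOddMultiple m y → HalfOddMultiple m z → HalfOddMultiple m u →
  ∃[ k ] norm (quat x y z u) ≡ k * (m * m)
norm-of-half-odd-multiples {m} {x} {y} {z} {u} (half-odd a x≡) (half-odd b y≡) (half-odd c z≡) (half-odd d u≡) =
  k , *-cancelʳ-≡ _ _ (+ 4) (begin
  norm (quat x y z u) * + 4 ≡⟨ norm-⊛ (quat x y z u) (+ 2) ⟨
  norm (quat x y z u ⊛ + 2) ≡⟨ cong norm (quat-≡ x≡ y≡ z≡ u≡) ⟩
  norm (quat (m * (1ℤ + + 2 * a)) (m * (1ℤ + + 2 * b)) (m * (1ℤ + + 2 * c)) (m * (1ℤ + + 2 * d)))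
                            ≡⟨ identity m a b c d ⟩
  k * (m * m) * + 4         ∎)
  where
  open ≡-Reasoning
  k = a * (a + 1ℤ) - + 3 * (b * (b + 1ℤ)) + c * (c + 1ℤ) - + 3 * (d * (d + 1ℤ)) - 1ℤ
  identity : ∀ m a b c d →
    m * (1ℤ + + 2 * a) * (m * (1ℤ + + 2 * a)) - + 3 * (m * (1ℤ + + 2 * b) * (m * (1ℤ + + 2 * b)))
      + m * (1ℤ + + 2 * c) * (m * (1ℤ + + 2 * c)) - + 3 * (m * (1ℤ + + 2 * d) * (m * (1ℤ + + 2 * d)))
    ≡ (a * (a + 1ℤ) - + 3 * (b * (b + 1ℤ)) + c * (c + 1ℤ) - + 3 * (d * (d + 1ℤ)) - 1ℤ) * (m * m) * + 4
  identity = solve-∀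

-- Candidates: near or far residues in x and z, near ones in y and u; the sum of the two positive-weight squares
-- increases by at most m² from (near, near) to (far, near) to (far, far).
reduce : ∀ m .{{_ : ℕ.NonZero m}} v →
    (∃[ w ] ∃[ t ] v ≡ w ⊕ t ⊛ + m × Within (+ m * + m) (norm w))
  ⊎ (∃[ k ] norm v ≡ k * (+ m * + m))
reduce m (quat x y z u) = choose (window-search (0<square m) d₁<K d₂≤d₁+K d₃≤d₂+K)
  where
  open BalancedResidues
  M = + m
  K = M * M
  X = balanced-residues m x
  Y = balanced-residues m y
  Z = balanced-residues m z
  U = balanced-residues m u
  C = + 3 * (near Y * near Y + near U * near U)
  d₁ = (near X * near X + near Z * near Z) - C
  d₂ = (far X * far X + near Z * near Z) - C
  d₃ = (far X * far X + far Z * far Z) - C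

  d₁<K : d₁ < K
  d₁<K = *-cancelˡ-<-nonNeg (+ 4) (<-by-difference _
    (+-mono-≤-< (+-mono-≤ (+-mono-≤ (i≤j⇒0≤j-i (near-small X)) (i≤j⇒0≤j-i (near-small Z)))
                          (0≤* (0≤+ 12) (+-mono-≤ (0≤square (near Y)) (0≤square (near U)))))
                (*-monoˡ-<-pos (+ 2) (0<square m)))
    (identity K (near X * near X) (near Z * near Z) (near Y * near Y + near U * near U)))
    where
    identity : ∀ K a b c → + 4 * K - + 4 * ((a + b) - + 3 * c) ≡ ((K - + 4 * a) + (K - + 4 * b) + + 12 * c) + + 2 * K
    identity = solve-∀

  d₂≤d₁+K : d₂ ≤ d₁ + K
  d₂≤d₁+K = ≤-by-difference _ (i≤j⇒0≤j-i (far-close X)) (identity (near X * near X) (far X * far X) (near Z * near Z) C K)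
    where
    identity : ∀ a a′ b C K → (a + b - C + K) - (a′ + b - C) ≡ (a + K) - a′
    identity = solve-∀

  d₃≤d₂+K : d₃ ≤ d₂ + K
  d₃≤d₂+K = ≤-by-difference _ (i≤j⇒0≤j-i (far-close Z)) (identity (far X * far X) (near Z * near Z) (far Z * far Z) C K)
    where
    identity : ∀ a b b′ C K → (a + b - C + K) - (a + b′ - C) ≡ (b + K) - b′
    identity = solve-∀

  candidate : ∀ w₁ t₁ w₃ t₃ → x ≡ w₁ + t₁ * M → z ≡ w₃ + t₃ * M → Within K ((w₁ * w₁ + w₃ * w₃) - C) →
    ∃[ w ] ∃[ t ] quat x y z u ≡ w ⊕ t ⊛ M × Within K (norm w)
  candidate w₁ t₁ w₃ t₃ x≡ z≡ within =
    quat w₁ (near Y) w₃ (near U) , quat t₁ (nearQuot Y) t₃ (nearQuot U) ,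
    quat-≡ x≡ (c≡near Y) z≡ (c≡near U) ,
    subst (Within K) (sym (norm-as-difference w₁ (near Y) w₃ (near U))) within

  exceptional : d₃ ≤ - K → ∃[ k ] norm (quat x y z u) ≡ k * K
  exceptional d₃≤-K =
    norm-of-half-odd-multiples
      (half-odd-multiple (far X)  (farQuot X)  4x²≡K (c≡far X))
      (half-odd-multiple (near Y) (nearQuot Y) 4y²≡K (c≡near Y))
      (half-odd-multiple (far Z)  (farQuot Z)  4z²≡K (c≡far Z))
      (half-odd-multiple (near U) (nearQuot U) 4u²≡K (c≡near U))
    where
    tight = below-window⇒tight (far-large X) (far-large Z) (near-small Y) (near-small U) d₃≤-K
    4x²≡K = proj₁ tight
    4z²≡K = proj₁ (proj₂ tight)
    4y²≡K = proj₁ (proj₂ (proj₂ tight))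
    4u²≡K = proj₂ (proj₂ (proj₂ tight))

  choose : Within K d₁ ⊎ Within K d₂ ⊎ Within K d₃ ⊎ d₃ ≤ - K →
    (∃[ w ] ∃[ t ] quat x y z u ≡ w ⊕ t ⊛ M × Within K (norm w)) ⊎ (∃[ k ] norm (quat x y z u) ≡ k * K)
  choose (inj₁ in₁)                 = inj₁ (candidate (near X) (nearQuot X) (near Z) (nearQuot Z) (c≡near X) (c≡near Z) in₁)
  choose (inj₂ (inj₁ in₂))          = inj₁ (candidate (far X) (farQuot X) (near Z) (nearQuot Z) (c≡far X) (c≡near Z) in₂)
  choose (inj₂ (inj₂ (inj₁ in₃)))   = inj₁ (candidate (far X) (farQuot X) (far Z) (farQuot Z) (c≡far X) (c≡far Z) in₃)
  choose (inj₂ (inj₂ (inj₂ d₃≤-K))) = inj₂ (exceptional d₃≤-K)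

-- Descent

no-proper-multiple : ∀ {p m} → Prime p → 2 ℕ.≤ m → m ℕ.< p → ∀ k → + m * + p ≢ k * (+ m * + m)
no-proper-multiple {m = 1} _ (ℕ.s≤s ()) _ _ _
no-proper-multiple {p} {m@(suc (suc _))} p-prime 2≤m m<p k mp≡kmm =
  Prime.notComposite p-prime (hasNonTrivialDivisor m<p (∣⇒∣ᵤ (divides k p≡km)))
  where
  identity : ∀ k m → k * (m * m) ≡ m * (k * m)
  identity = solve-∀
  p≡km : + p ≡ k * + m
  p≡km = *-cancelˡ-≡ (+ m) (+ p) (k * + m) (trans mp≡kmm (identity k (+ m)))

∣quotient∣< : ∀ m r → Within (+ m * + m) (+ m * r) → ∣ r ∣ ℕ.< m
∣quotient∣< m r (lower , upper) =
  bound r (*-cancelˡ-<-nonNeg (+ m) (subst (_< + m * r) (neg-distribʳ-* (+ m) (+ m)) lower))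
          (*-cancelˡ-<-nonNeg (+ m) upper)
  where
  bound : ∀ r → - + m < r → r < + m → ∣ r ∣ ℕ.< m
  bound (+ n)    _    (+<+ n<m) = n<m
  bound -[1+ n ] -m<r _         = drop‿+<+ (neg-cancel-< -m<r)

RepresentedMultiple : ℕ → ℕ → Set
RepresentedMultiple p b = ∃[ m ] 0 ℕ.< m × m ℕ.< b × Represented (+ m * + p)

represented-multiple : ∀ {p b} r → r ≢ 0ℤ → ∣ r ∣ ℕ.< b → Represented (+ p * r) → RepresentedMultiple p b
represented-multiple {p} r r≢0 ∣r∣<b rep =
  ∣ r ∣ , ℕₚ.n≢0⇒n>0 (r≢0 ∘ ∣i∣≡0⇒i≡0) , ∣r∣<b , represented-abs p r rep

descent-step : ∀ {p m} → Prime p → 2 ℕ.≤ m → m ℕ.< p → Represented (+ m * + p) → RepresentedMultiple p m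
descent-step {m = 1} _ (ℕ.s≤s ()) _ _
descent-step {p} {m@(suc (suc _))} p-prime 2≤m m<p (v , Nv≡Mp) = reduced (reduce m v)
  where
  M = + m
  reduced : (∃[ w ] ∃[ t ] v ≡ w ⊕ t ⊛ M × Within (M * M) (norm w)) ⊎ (∃[ k ] norm v ≡ k * (M * M)) →
            RepresentedMultiple p m
  reduced (inj₂ (k , Nv≡kMM)) = ⊥-elim (no-proper-multiple p-prime 2≤m m<p k (trans (sym Nv≡Mp) Nv≡kMM))
  reduced (inj₁ (w , t , v≡w⊕tM , within)) =
    represented-multiple r r≢0 (∣quotient∣< m r (subst (Within (M * M)) Nw≡Mr within)) (real r ⊕ t · conj w , Nv′≡pr)
    where
    open ≡-Reasoning
    c = + 2 * polar w t + M * norm t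
    r = + p - c
    cancel : ∀ a b → a ≡ (a + b) - b
    cancel = solve-∀
    factor : ∀ m p c → m * p - m * c ≡ m * (p - c)
    factor = solve-∀
    rearrange : ∀ m p r → m * p * (m * r) ≡ p * r * (m * m)
    rearrange = solve-∀
    Nw≡Mr : norm w ≡ M * r
    Nw≡Mr = begin
      norm w                   ≡⟨ cancel (norm w) (M * c) ⟩
      (norm w + M * c) - M * c ≡⟨ cong (_- M * c) (norm-⊕⊛ w t M) ⟨
      norm (w ⊕ t ⊛ M) - M * c ≡⟨ cong (λ q → norm q - M * c) v≡w⊕tM ⟨
      norm v - M * c           ≡⟨ cong (_- M * c) Nv≡Mp ⟩
      M * + p - M * c          ≡⟨ factor M (+ p) c ⟩
      M * r                    ∎
    r≢0 : r ≢ 0ℤ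
    r≢0 r≡0 = no-proper-multiple p-prime 2≤m m<p (norm t) (begin
      M * + p          ≡⟨ Nv≡Mp ⟨
      norm v           ≡⟨ cong norm v≡w⊕tM ⟩
      norm (w ⊕ t ⊛ M) ≡⟨ cong (λ w → norm (w ⊕ t ⊛ M)) w≡𝟘 ⟩
      norm (𝟘 ⊕ t ⊛ M) ≡⟨ cong norm (𝟘-⊕ (t ⊛ M)) ⟩
      norm (t ⊛ M)     ≡⟨ norm-⊛ t M ⟩
      norm t * (M * M) ∎)
      where
      w≡𝟘 = anisotropic w (trans Nw≡Mr (trans (cong (M *_) r≡0) (*-zeroʳ M)))
    Nv′≡pr : norm (real r ⊕ t · conj w) ≡ + p * r
    Nv′≡pr = *-cancelʳ-≡ _ _ (M * M) (begin
      norm (real r ⊕ t · conj w) * (M * M) ≡⟨ norm-descended w t M r Nw≡Mr ⟩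
      norm (w ⊕ t ⊛ M) * norm w            ≡⟨ cong (λ q → norm q * norm w) v≡w⊕tM ⟨
      norm v * norm w                      ≡⟨ cong₂ _*_ Nv≡Mp Nw≡Mr ⟩
      M * + p * (M * r)                    ≡⟨ rearrange M (+ p) r ⟩
      + p * r * (M * M)                    ∎)

descent : ∀ {p} → Prime p → RepresentedMultiple p p → Represented (+ p)
descent {p} p-prime (m , 0<m , m<p , rep) = go m (<-wellFounded m) 0<m m<p rep
  where
  go : ∀ m → Acc ℕ._<_ m → 0 ℕ.< m → m ℕ.< p → Represented (+ m * + p) → Represented (+ p)
  go 1 _ _ _ rep = subst Represented (*-identityˡ (+ p)) rep
  go m@(suc (suc _)) (acc smaller) _ m<p rep = continue (descent-step p-prime (ℕ.s≤s (ℕ.s≤s ℕ.z≤n)) m<p rep)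
    where
    continue : RepresentedMultiple p m → Represented (+ p)
    continue (m′ , 0<m′ , m′<m , rep′) = go m′ (smaller m′<m) 0<m′ (ℕₚ.<-trans m′<m m<p) rep′

-- A first multiple of p

euclid-ℤ : ∀ {p} a b → Prime p → + p ∣ a * b → (+ p ∣ a) ⊎ (+ p ∣ b)
euclid-ℤ a b p-prime p∣ab =
  Sum.map ∣ᵤ⇒∣ ∣ᵤ⇒∣ (euclidsLemma ∣ a ∣ ∣ b ∣ p-prime (subst (_ ∣ℕ_) (abs-* a b) (∣⇒∣ᵤ p∣ab)))

multiple-below≡0 : ∀ {p n} → + p ∣ n → ∣ n ∣ ℕ.< p → n ≡ 0ℤ
multiple-below≡0 p∣n ∣n∣<p = ∣i∣≡0⇒i≡0 (below (∣⇒∣ᵤ p∣n) ∣n∣<p)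
  where
  below : ∀ {p m} → p ∣ℕ m → m ℕ.< p → m ≡ 0
  below {m = zero}  _   _   = refl
  below {m = suc _} p∣m m<p = ⊥-elim (ℕₚ.<⇒≱ m<p (∣⇒≤ p∣m))

squares-distinct-mod : ∀ {p x x′} → Prime p → x ℕ.+ x′ ℕ.< p → + p ∣ + x * + x - + x′ * + x′ → x ≡ x′
squares-distinct-mod {p} {x} {x′} p-prime x+x′<p p∣x²-x′² =
  [ x-x′ , x+x′ ]′ (euclid-ℤ (+ x - + x′) (+ x + + x′) p-prime (subst (+ p ∣_) (factor (+ x) (+ x′)) p∣x²-x′²))
  where
  factor : ∀ a b → a * a - b * b ≡ (a - b) * (a + b)
  factor = solve-∀
  x-x′ : + p ∣ + x - + x′ → x ≡ x′
  x-x′ p∣ = +-injective (i-j≡0⇒i≡j _ _ (multiple-below≡0 p∣ (ℕₚ.≤-<-trans (∣i-j∣≤∣i∣+∣j∣ (+ x) (+ x′)) x+x′<p)))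
  x+x′ : + p ∣ + x + + x′ → x ≡ x′
  x+x′ p∣ = trans (ℕₚ.m+n≡0⇒m≡0 x x+x′≡0) (sym (ℕₚ.m+n≡0⇒n≡0 x x+x′≡0))
    where
    x+x′≡0 : x ℕ.+ x′ ≡ 0
    x+x′≡0 = +-injective (trans (pos-+ x x′) (multiple-below≡0 p∣ (ℕₚ.≤-<-trans (∣i+j∣≤∣i∣+∣j∣ (+ x) (+ x′)) x+x′<p)))

%ℕ≡⇒∣- : ∀ n a b .{{_ : ℕ.NonZero n}} → a %ℕ n ≡ b %ℕ n → + n ∣ a - b
%ℕ≡⇒∣- n a b same = divides (a /ℕ n - b /ℕ n) (begin
  a - b
    ≡⟨ cong₂ _-_ (a≡a%ℕn+[a/ℕn]*n a n) (a≡a%ℕn+[a/ℕn]*n b n) ⟩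
  (+ (a %ℕ n) + a /ℕ n * + n) - (+ (b %ℕ n) + b /ℕ n * + n)
    ≡⟨ cong (λ r → (+ (a %ℕ n) + a /ℕ n * + n) - (+ r + b /ℕ n * + n)) same ⟨
  (+ (a %ℕ n) + a /ℕ n * + n) - (+ (a %ℕ n) + b /ℕ n * + n)
    ≡⟨ identity (+ (a %ℕ n)) (a /ℕ n) (b /ℕ n) (+ n) ⟩
  (a /ℕ n - b /ℕ n) * + n
    ∎)
  where
  open ≡-Reasoning
  identity : ∀ r q q′ n → (r + q * n) - (r + q′ * n) ≡ (q - q′) * n
  identity = solve-∀

norm-bounds : ∀ h x y → 1 ℕ.≤ h → x ℕ.≤ h → y ℕ.≤ h →
  Within (+ suc (h ℕ.+ h) * + suc (h ℕ.+ h)) (norm (quat (+ x) (+ y) 1ℤ 0ℤ))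
norm-bounds h x y 1≤h x≤h y≤h = subst (λ P → Within (P * P) (norm (quat X Y 1ℤ 0ℤ))) (sym P≡1+H+H) (lower , upper)
  where
  H = + h
  X = + x
  Y = + y
  P≡1+H+H : + suc (h ℕ.+ h) ≡ 1ℤ + (H + H)
  P≡1+H+H = trans (pos-+ 1 (h ℕ.+ h)) (cong (_+_ 1ℤ) (pos-+ h h))
  0≤H-X = i≤j⇒0≤j-i (+≤+ x≤h)
  0≤H-Y = i≤j⇒0≤j-i (+≤+ y≤h)
  0≤H+X = subst (0ℤ ≤_) (pos-+ h x) (0≤+ (h ℕ.+ x))
  0≤H+Y = subst (0ℤ ≤_) (pos-+ h y) (0≤+ (h ℕ.+ y))
  upper-gap : ∀ H X Y → (1ℤ + (H + H)) * (1ℤ + (H + H)) - (X * X - + 3 * (Y * Y) + 1ℤ * 1ℤ - + 3 * (0ℤ * 0ℤ))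
              ≡ ((H - X) * (H + X) + + 3 * (H * H) + + 3 * (Y * Y)) + + 4 * H
  upper-gap = solve-∀
  lower-gap : ∀ H X Y → (X * X - + 3 * (Y * Y) + 1ℤ * 1ℤ - + 3 * (0ℤ * 0ℤ)) - - ((1ℤ + (H + H)) * (1ℤ + (H + H)))
              ≡ (X * X + + 3 * ((H - Y) * (H + Y)) + H * H + + 4 * H) + + 2
  lower-gap = solve-∀
  upper = <-by-difference _
    (+-mono-≤-< (+-mono-≤ (+-mono-≤ (0≤* 0≤H-X 0≤H+X) (0≤* (0≤+ 3) (0≤square H))) (0≤* (0≤+ 3) (0≤square Y)))
                (*-monoˡ-<-pos (+ 4) (+<+ 1≤h)))
    (upper-gap H X Y)
  lower = <-by-difference _
    (+-mono-≤-< (+-mono-≤ (+-mono-≤ (+-mono-≤ (0≤square X) (0≤* (0≤+ 3) (0≤* 0≤H-Y 0≤H+Y))) (0≤square H))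
                          (0≤* (0≤+ 4) (0≤+ h)))
                (+<+ (ℕ.s≤s ℕ.z≤n)))
    (lower-gap H X Y)

-- Pigeonhole: the h + 1 numbers x² + 1 and the h + 1 numbers 3y² (x, y ≤ h) are pairwise incongruent modulo
-- p = 2h + 1 within each family, so some x² + 1 ≡ 3y² (mod p).
initial-multiple : ∀ {h} → Prime (suc (h ℕ.+ h)) → 2 ℕ.≤ h → RepresentedMultiple (suc (h ℕ.+ h)) (suc (h ℕ.+ h))
initial-multiple {h} p-prime 2≤h = collide (Fₚ.pigeonhole p<2[h+1] residue)
  where
  p = suc (h ℕ.+ h)
  Point = Fin (suc h) ⊎ Fin (suc h)

  value : Point → ℤ
  value (inj₁ x) = + toℕ x * + toℕ x + 1ℤ
  value (inj₂ y) = + 3 * (+ toℕ y * + toℕ y)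

  residue : Fin (suc h ℕ.+ suc h) → Fin p
  residue i = fromℕ< (n%ℕd<d (value (splitAt (suc h) i)) p)

  p<2[h+1] : p ℕ.< suc h ℕ.+ suc h
  p<2[h+1] = ℕ.s≤s (ℕₚ.≤-reflexive (sym (ℕₚ.+-suc h h)))

  ≤h : ∀ (x : Fin (suc h)) → toℕ x ℕ.≤ h
  ≤h x = ℕ.s≤s⁻¹ (Fₚ.toℕ<n x)

  sum<p : ∀ (x x′ : Fin (suc h)) → toℕ x ℕ.+ toℕ x′ ℕ.< p
  sum<p x x′ = ℕ.s≤s (ℕₚ.+-mono-≤ (≤h x) (≤h x′))

  p∤3 : ¬ (+ p ∣ + 3)
  p∤3 p∣3 = ℕₚ.<⇒≱ (ℕ.s≤s (ℕₚ.≤-trans (ℕₚ.n≤1+n 3) (ℕₚ.+-mono-≤ 2≤h 2≤h))) (∣⇒≤ (∣⇒∣ᵤ p∣3))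

  mixed : ∀ x y → x ℕ.≤ h → y ℕ.≤ h → + p ∣ (+ x * + x + 1ℤ) - + 3 * (+ y * + y) → RepresentedMultiple p p
  mixed x y x≤h y≤h (divides k eq) =
    represented-multiple k k≢0
      (∣quotient∣< p k (subst (Within (+ p * + p)) N≡pk (norm-bounds h x y (ℕₚ.≤-trans (ℕₚ.n≤1+n 1) 2≤h) x≤h y≤h)))
      (quat (+ x) (+ y) 1ℤ 0ℤ , N≡pk)
    where
    rearrange : ∀ X Y → X * X - + 3 * (Y * Y) + 1ℤ * 1ℤ - + 3 * (0ℤ * 0ℤ) ≡ (X * X + 1ℤ) - + 3 * (Y * Y)
    rearrange = solve-∀
    N≡pk : norm (quat (+ x) (+ y) 1ℤ 0ℤ) ≡ + p * k
    N≡pk = trans (rearrange (+ x) (+ y)) (trans eq (*-comm k (+ p)))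
    k≢0 : k ≢ 0ℤ
    k≢0 k≡0 = 1≢0 (cong Quaternion.j q≡𝟘)
      where
      q≡𝟘 : quat (+ x) (+ y) 1ℤ 0ℤ ≡ 𝟘
      q≡𝟘 = anisotropic (quat (+ x) (+ y) 1ℤ 0ℤ) (trans N≡pk (trans (cong (+ p *_) k≡0) (*-zeroʳ (+ p))))
      1≢0 : 1ℤ ≢ 0ℤ
      1≢0 ()

  from-collision : (a b : Point) → a ≢ b → + p ∣ value a - value b → RepresentedMultiple p p
  from-collision (inj₁ x) (inj₁ x′) a≢b p∣ =
    ⊥-elim (a≢b (cong inj₁ (Fₚ.toℕ-injective (squares-distinct-mod p-prime (sum<p x x′)
      (subst (+ p ∣_) (cancel-1 (+ toℕ x * + toℕ x) (+ toℕ x′ * + toℕ x′)) p∣)))))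
    where
    cancel-1 : ∀ a b → (a + 1ℤ) - (b + 1ℤ) ≡ a - b
    cancel-1 = solve-∀
  from-collision (inj₂ y) (inj₂ y′) a≢b p∣ =
    ⊥-elim ([ p∤3 , a≢b ∘ cong inj₂ ∘ Fₚ.toℕ-injective ∘ squares-distinct-mod p-prime (sum<p y y′) ]′
      (euclid-ℤ (+ 3) _ p-prime (subst (+ p ∣_) (factor-3 (+ toℕ y * + toℕ y) (+ toℕ y′ * + toℕ y′)) p∣)))
    where
    factor-3 : ∀ a b → + 3 * a - + 3 * b ≡ + 3 * (a - b)
    factor-3 = solve-∀
  from-collision (inj₁ x) (inj₂ y) _ p∣ = mixed (toℕ x) (toℕ y) (≤h x) (≤h y) p∣
  from-collision (inj₂ y) (inj₁ x) _ p∣ =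
    mixed (toℕ x) (toℕ y) (≤h x) (≤h y) (subst (+ p ∣_) (flip (value (inj₂ y)) (value (inj₁ x))) (∣m⇒∣-m p∣))
    where
    flip : ∀ a b → - (a - b) ≡ b - a
    flip = solve-∀

  collide : ∃₂ (λ i j → i Fin.< j × residue i ≡ residue j) → RepresentedMultiple p p
  collide (i , j , i<j , same) =
    from-collision (split i) (split j) distinct (%ℕ≡⇒∣- p (value (split i)) (value (split j)) same-residue)
    where
    open ≡-Reasoning
    split = splitAt (suc h)
    distinct : split i ≢ split j
    distinct eq = Fₚ.<-irrefl (begin
      i                              ≡⟨ Fₚ.join-splitAt (suc h) (suc h) i ⟨
      join (suc h) (suc h) (split i) ≡⟨ cong (join (suc h) (suc h)) eq ⟩
      join (suc h) (suc h) (split j) ≡⟨ Fₚ.join-splitAt (suc h) (suc h) j ⟩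
      j                              ∎) i<j
    same-residue : value (split i) %ℕ p ≡ value (split j) %ℕ p
    same-residue = trans (sym (Fₚ.toℕ-fromℕ< _)) (trans (cong toℕ same) (Fₚ.toℕ-fromℕ< _))

odd-prime : ∀ {p} → Prime p → p ≢ 2 → ∃[ h ] p ≡ suc (h ℕ.+ h)
odd-prime {p} p-prime p≢2 = from-parity (p ℕ.% 2) (m%n<n p 2) (m≡m%n+[m/n]*n p 2)
  where
  2<p : 2 ℕ.< p
  2<p = ℕₚ.≤∧≢⇒< (ℕ.nonTrivial⇒n>1 p {{prime⇒nonTrivial p-prime}}) (p≢2 ∘ sym)
  double : ∀ h → h ℕ.* 2 ≡ h ℕ.+ h
  double = ℕ-solve-∀
  from-parity : ∀ r → r ℕ.< 2 → p ≡ r ℕ.+ p ℕ./ 2 ℕ.* 2 → ∃[ h ] p ≡ suc (h ℕ.+ h)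
  from-parity 0 _ p≡2q = ⊥-elim (Prime.notComposite p-prime (hasNonTrivialDivisor 2<p (ℕᵈ.divides (p ℕ./ 2) p≡2q)))
  from-parity 1 _ p≡1+2q = p ℕ./ 2 , trans p≡1+2q (cong suc (double (p ℕ./ 2)))
  from-parity (suc (suc _)) (ℕ.s≤s (ℕ.s≤s ())) _

prime-represented : ∀ {p} → Prime p → Represented (+ p)
prime-represented {p} p-prime with p ℕₚ.≟ 2
... | yes refl = quat 1ℤ 0ℤ 1ℤ 0ℤ , refl
... | no p≢2   = odd (odd-prime p-prime p≢2)
  where
  odd : ∃[ h ] p ≡ suc (h ℕ.+ h) → Represented (+ p)
  odd (0 , refl)             = ⊥-elim (¬prime[1] p-prime)
  odd (1 , refl)             = quat (+ 3) 1ℤ 0ℤ 1ℤ , refl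
  odd (suc (suc _) , refl)   = descent p-prime (initial-multiple p-prime (ℕ.s≤s (ℕ.s≤s ℕ.z≤n)))

natural-represented : ∀ n → Represented (+ n)
natural-represented zero      = 𝟘 , refl
natural-represented n@(suc _) =
  subst (Represented ∘ +_) (sym (isFactorisation f)) (represented-product (All.map prime-represented (factorsPrime f)))
  where
  open PrimeFactorisation
  f = factorise n

represented : ∀ n → Represented n
represented (+ n)    = natural-represented n
represented -[1+ n ] = represented-neg (natural-represented (suc n))

proposition5 : (n : ℤ) → ∃[ x ] ∃[ y ] ∃[ z ] ∃[ u ] n ≡ x * x - + 3 * (y * y) + z * z - + 3 * (u * u)
proposition5 n with represented n
... | quat x y z u , N≡n = x , y , z , u , sym N≡n
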